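{- Let $(T_1,c_1)$, $(T'_1,c'_1)$ and $(T_2,c_2)$ be Misra–Gries sketches of size $k$, and let $(\hat T,\hat c)=\mathrm{Merge}(T_1,c_1,T_2,c_2)$ and $(\hat T',\hat c')=\mathrm{Merge}(T'_1,c'_1,T_2,c_2)$. If $T'_1\subseteq T_1$ and $c_{1i}-c'_{1i}\in\{0,1\}$ for all $i\in T_1$, then at least one of the following holds: (1) $\hat T'\subseteq\hat T$ and $\hat c_i-\hat c'_i\in\{0,1\}$ for all $i\in\hat T$; or (2) $\hat T\subseteq\hat T'$ and $\hat c'_i-\hat c_i\in\{0,1\}$ for all $i\in\hat T'$.
   Context: A sketch of size $k$ is a set of at most $k$ keys $T$ with positive counters $c_i$, $i\in T$ (keys with count zero are not stored); counters of keys not in $T$ are implicitly $0$. $\mathrm{Merge}(T_1,c_1,T_2,c_2)$: compute the counter-wise sum $c_1+c_2$ over $T_1\cup T_2$ (up to $2k$ counters), subtract the value of the $(k+1)$-th largest of these counters (taken to be $0$ if there are at most $k$ counters) from all counters, and remove all non-positive counters, leaving at most $k$ keys. -}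

module Defs where

open import Data.Nat using (ℕ; zero; suc; _+_; _∸_; _≤_; _<_)
open import Data.Nat.Properties using (≤-decTotalOrder; _<?_)
open import Data.Fin using (Fin)
open import Data.List using (List; []; _∷_; map; reverse; length; filter; allFin)
open import Data.Product using (_×_)
open import Data.Sum using (_⊎_)
open import Relation.Binary.PropositionalEquality using (_≡_)
import Data.List.Sort

open Data.List.Sort ≤-decTotalOrder using (sort)

-- A sketch is represented by its
-- counter function c : Fin n → ℕ; the key set is T = { i | 0 < c i }
-- (keys with count zero are not stored / counters of keys not in T are 0).
Counters : ℕ → Set
Counters n = Fin n → ℕ

_∈T_ : ∀ {n} → Fin n → Counters n → Set
i ∈T c = 0 < c i

support-size : ∀ {n} → Counters n → ℕ
support-size {n} c = length (filter (λ i → 0 <? c i) (allFin n))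

IsSketch : ∀ {n} → ℕ → Counters n → Set
IsSketch k c = support-size c ≤ k

_⊆T_ : ∀ {n} → Counters n → Counters n → Set
c' ⊆T c = ∀ i → i ∈T c' → i ∈T c

-- c i - c' i ∈ {0,1} for all i ∈ T   (stated without truncated subtraction)
DiffZeroOne : ∀ {n} → Counters n → Counters n → Set
DiffZeroOne c c' = ∀ i → i ∈T c → (c i ≡ c' i ⊎ c i ≡ suc (c' i))

nth0 : ℕ → List ℕ → ℕ
nth0 _       []       = 0
nth0 zero    (x ∷ xs) = x
nth0 (suc j) (x ∷ xs) = nth0 j xs

-- the (k+1)-th largest value of the counters (0 if there are at most k of them).
-- Taken over all keys of the universe: extra zero counters do not change it.
kPlus1thLargest : ∀ {n} → ℕ → Counters n → ℕ
kPlus1thLargest {n} k c = nth0 k (reverse (sort (map c (allFin n))))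

-- Merge: counter-wise sum, subtract the (k+1)-th largest counter, drop
-- non-positive counters (truncated subtraction yields 0 = not stored).
Merge : ∀ {n} → ℕ → Counters n → Counters n → Counters n
Merge k c₁ c₂ i = (c₁ i + c₂ i) ∸ kPlus1thLargest k (λ j → c₁ j + c₂ j)

{-# OPTIONS --safe #-}
module Submission where

-- With s = c₁ + c₂ and s' = c₁' + c₂ the hypotheses say s'ᵢ ≤ sᵢ ≤ s'ᵢ + 1 for every key.
-- The (k+1)-th largest value t of a counter vector is pinned down by counting: at least k+1
-- values are ≥ t and at most k are > t.  Comparing these counts shows that raising every
-- value by at most one raises t by at most one, so the thresholds satisfy t' ≤ t ≤ t' + 1.
-- If t = t', subtracting the common threshold preserves the per-key relation; if t = t' + 1,
-- then sᵢ ∸ t = pred (sᵢ ∸ t') lies at most one below s'ᵢ ∸ t', and the two merges swap roles.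

open import Defs
open import Data.Nat using (ℕ; zero; suc; pred; _+_; _∸_; _≤_; _≰_; _<_; z≤n; s≤s; _≤?_; _<?_)
open import Data.Nat.Properties
  using (≤-decTotalOrder; ≤-refl; ≤-reflexive; ≤-trans; ≤-antisym; <-irrefl; <-≤-trans; ≮⇒≥;
         n≤1+n; m≤n⇒m≤1+n; n≤0⇒n≡0; m≤n⇒m<n∨m≡n; +-suc; +-cancelˡ-≤; 0∸n≡0; pred[m∸n]≡m∸[1+n];
         module ≤-Reasoning)
open import Data.List using (List; []; _∷_; map; reverse; length; filter; allFin)
open import Data.List.Properties using (length-map; length-tabulate; filter-accept; filter-reject; unfold-reverse)
open import Data.List.Relation.Unary.All as All using (All; []; _∷_)
open import Data.List.Relation.Unary.AllPairs using (AllPairs; []; _∷_)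
open import Data.List.Relation.Unary.AllPairs.Properties using (++⁺)
open import Data.List.Relation.Unary.Linked.Properties using (Linked⇒AllPairs)
open import Data.List.Relation.Binary.Permutation.Propositional using (_↭_; ↭-sym; ↭-trans)
open import Data.List.Relation.Binary.Permutation.Propositional.Properties
  using (filter-↭; ↭-reverse; ↭-length; All-resp-↭)
open import Data.Product using (_×_; _,_)
open import Data.Sum as Sum using (_⊎_; inj₁; inj₂)
open import Data.Empty using (⊥-elim)
open import Function using (flip; _∘_)
open import Relation.Nullary using (yes; no)
open import Relation.Binary.PropositionalEquality using (_≡_; refl; sym; trans; cong; subst)
import Data.List.Sort

open Data.List.Sort ≤-decTotalOrder using (sort; sort-↭; sort-↗)

private
  variable
    a b v x : ℕ
    xs : List ℕ

AllPairs-reverse : ∀ {A : Set} {R : A → A → Set} {xs : List A} →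
                   AllPairs R xs → AllPairs (flip R) (reverse xs)
AllPairs-reverse {xs = []} [] = []
AllPairs-reverse {xs = x ∷ xs} (Rx ∷ Rxs) rewrite unfold-reverse x xs =
  ++⁺ (AllPairs-reverse Rxs) ([] ∷ [])
      (All.map (_∷ []) (All-resp-↭ (↭-sym (↭-reverse xs)) Rx))

count≥ : ℕ → List ℕ → ℕ
count≥ v xs = length (filter (v ≤?_) xs)

count≥-accept : v ≤ x → count≥ v (x ∷ xs) ≡ suc (count≥ v xs)
count≥-accept v≤x = cong length (filter-accept (_ ≤?_) v≤x)

count≥-reject : v ≰ x → count≥ v (x ∷ xs) ≡ count≥ v xs
count≥-reject v≰x = cong length (filter-reject (_ ≤?_) v≰x)

count≥-↭ : ∀ v {xs ys} → xs ↭ ys → count≥ v xs ≡ count≥ v ys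
count≥-↭ v p = ↭-length (filter-↭ (v ≤?_) p)

count≥-∷-≤ : ∀ v x xs → count≥ v (x ∷ xs) ≤ suc (count≥ v xs)
count≥-∷-≤ v x xs with v ≤? x
... | yes v≤x rewrite count≥-accept {xs = xs} v≤x = ≤-refl
... | no v≰x rewrite count≥-reject {xs = xs} v≰x = n≤1+n _

count≥-map-≤ : ∀ {A : Set} (f g : A → ℕ) {v w : ℕ} (ys : List A) →
               (∀ y → w ≤ f y → v ≤ g y) → count≥ w (map f ys) ≤ count≥ v (map g ys)
count≥-map-≤ f g [] _ = z≤n
count≥-map-≤ f g {v} {w} (y ∷ ys) w≤f⇒v≤g with w ≤? f y | v ≤? g y
... | yes w≤f | yes v≤g
  rewrite count≥-accept {xs = map f ys} w≤f | count≥-accept {xs = map g ys} v≤g =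
    s≤s (count≥-map-≤ f g ys w≤f⇒v≤g)
... | yes w≤f | no v≰g = ⊥-elim (v≰g (w≤f⇒v≤g y w≤f))
... | no w≰f | yes v≤g
  rewrite count≥-reject {xs = map f ys} w≰f | count≥-accept {xs = map g ys} v≤g =
    m≤n⇒m≤1+n (count≥-map-≤ f g ys w≤f⇒v≤g)
... | no w≰f | no v≰g
  rewrite count≥-reject {xs = map f ys} w≰f | count≥-reject {xs = map g ys} v≰g =
    count≥-map-≤ f g ys w≤f⇒v≤g

count≥-suc-≡0 : All (_≤ x) xs → count≥ (suc x) xs ≡ 0
count≥-suc-≡0 [] = refl
count≥-suc-≡0 {x} {y ∷ ys} (y≤x ∷ ys≤x) with suc x ≤? y
... | yes x<y = ⊥-elim (<-irrefl refl (≤-trans x<y y≤x))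
... | no x≮y rewrite count≥-reject {xs = ys} x≮y = count≥-suc-≡0 ys≤x

Descending : List ℕ → Set
Descending = AllPairs (flip _≤_)

All-nth0 : ∀ {P : ℕ → Set} k xs → All P xs → k < length xs → P (nth0 k xs)
All-nth0 zero (x ∷ xs) (px ∷ _) _ = px
All-nth0 (suc k) (x ∷ xs) (_ ∷ pxs) (s≤s k<) = All-nth0 k xs pxs k<

nth0-≥-length : ∀ k xs → length xs ≤ k → nth0 k xs ≡ 0
nth0-≥-length k [] _ = refl
nth0-≥-length (suc k) (x ∷ xs) (s≤s len≤k) = nth0-≥-length k xs len≤k

count≥-suc-nth0 : ∀ k xs → Descending xs → k < length xs → count≥ (suc (nth0 k xs)) xs ≤ k
count≥-suc-nth0 zero (x ∷ xs) (xs≤x ∷ _) _ = ≤-reflexive (count≥-suc-≡0 (≤-refl ∷ xs≤x))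
count≥-suc-nth0 (suc k) (x ∷ xs) (_ ∷ desc) (s≤s k<) =
  ≤-trans (count≥-∷-≤ _ x xs) (s≤s (count≥-suc-nth0 k xs desc k<))

nth0-count≥ : ∀ k xs → Descending xs → k < length xs → suc k ≤ count≥ (nth0 k xs) xs
nth0-count≥ zero (x ∷ xs) _ _ rewrite count≥-accept {xs = xs} (≤-refl {x}) = s≤s z≤n
nth0-count≥ (suc k) (x ∷ xs) (xs≤x ∷ desc) (s≤s k<)
  rewrite count≥-accept {xs = xs} (All-nth0 k xs xs≤x k<) = s≤s (nth0-count≥ k xs desc k<)

AtMostOneAbove : ℕ → ℕ → Set
AtMostOneAbove a b = a ≡ b ⊎ a ≡ suc b

AtMostOneAbove⇒≥ : AtMostOneAbove a b → b ≤ a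
AtMostOneAbove⇒≥ (inj₁ refl) = ≤-refl
AtMostOneAbove⇒≥ (inj₂ refl) = n≤1+n _

AtMostOneAbove⇒≤suc : AtMostOneAbove a b → a ≤ suc b
AtMostOneAbove⇒≤suc (inj₁ refl) = n≤1+n _
AtMostOneAbove⇒≤suc (inj₂ refl) = ≤-refl

≥∧≤suc⇒AtMostOneAbove : b ≤ a → a ≤ suc b → AtMostOneAbove a b
≥∧≤suc⇒AtMostOneAbove b≤a a≤1+b with m≤n⇒m<n∨m≡n a≤1+b
... | inj₁ (s≤s a≤b) = inj₁ (≤-antisym a≤b b≤a)
... | inj₂ a≡1+b = inj₂ a≡1+b

AtMostOneAbove-+ʳ : ∀ c → AtMostOneAbove a b → AtMostOneAbove (a + c) (b + c)
AtMostOneAbove-+ʳ c (inj₁ refl) = inj₁ refl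
AtMostOneAbove-+ʳ c (inj₂ refl) = inj₂ refl

suc-∸-AtMostOneAbove : ∀ a t → AtMostOneAbove (suc a ∸ t) (a ∸ t)
suc-∸-AtMostOneAbove a zero = inj₂ refl
suc-∸-AtMostOneAbove zero (suc t) = inj₁ (0∸n≡0 t)
suc-∸-AtMostOneAbove (suc a) (suc t) = suc-∸-AtMostOneAbove a t

AtMostOneAbove-∸ : ∀ t → AtMostOneAbove a b → AtMostOneAbove (a ∸ t) (b ∸ t)
AtMostOneAbove-∸ t (inj₁ refl) = inj₁ refl
AtMostOneAbove-∸ {b = b} t (inj₂ refl) = suc-∸-AtMostOneAbove b t

AtMostOneAbove-pred : AtMostOneAbove a b → AtMostOneAbove b (pred a)
AtMostOneAbove-pred {b = zero} (inj₁ refl) = inj₁ refl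
AtMostOneAbove-pred {b = suc _} (inj₁ refl) = inj₂ refl
AtMostOneAbove-pred (inj₂ refl) = inj₁ refl

AtMostOneAbove-∸-suc : ∀ t → AtMostOneAbove a b → AtMostOneAbove (b ∸ t) (a ∸ suc t)
AtMostOneAbove-∸-suc {a} t a≳b =
  subst (AtMostOneAbove _) (pred[m∸n]≡m∸[1+n] a t) (AtMostOneAbove-pred (AtMostOneAbove-∸ t a≳b))

module _ {n : ℕ} {c c' : Counters n} where

  ⊆T×DiffZeroOne⇒AtMostOneAbove : c' ⊆T c → DiffZeroOne c c' → ∀ i → AtMostOneAbove (c i) (c' i)
  ⊆T×DiffZeroOne⇒AtMostOneAbove c'⊆c c-c'∈01 i with 0 <? c i
  ... | yes i∈c = c-c'∈01 i i∈c
  ... | no i∉c = inj₁ (trans (n≤0⇒n≡0 (≮⇒≥ i∉c)) (sym (n≤0⇒n≡0 (≮⇒≥ (i∉c ∘ c'⊆c i)))))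

  AtMostOneAbove⇒⊆T×DiffZeroOne : (∀ i → AtMostOneAbove (c i) (c' i)) → c' ⊆T c × DiffZeroOne c c'
  AtMostOneAbove⇒⊆T×DiffZeroOne c≳c' =
    (λ i i∈c' → <-≤-trans i∈c' (AtMostOneAbove⇒≥ (c≳c' i))) , (λ i _ → c≳c' i)

module _ {n : ℕ} where

  values : Counters n → List ℕ
  values f = map f (allFin n)

  descending : Counters n → List ℕ
  descending f = reverse (sort (values f))

  descending-↭ : ∀ f → descending f ↭ values f
  descending-↭ f = ↭-trans (↭-reverse _) (sort-↭ (values f))

  descending-Descending : ∀ f → Descending (descending f)
  descending-Descending f = AllPairs-reverse (Linked⇒AllPairs ≤-trans (sort-↗ (values f)))

  length-descending : ∀ f → length (descending f) ≡ n
  length-descending f =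
    trans (↭-length (descending-↭ f)) (trans (length-map f (allFin n)) (length-tabulate _))

module _ {n : ℕ} (k : ℕ) where

  kPlus1thLargest-≡0 : ∀ f → n ≤ k → kPlus1thLargest k f ≡ 0
  kPlus1thLargest-≡0 f n≤k =
    nth0-≥-length k (descending f) (subst (_≤ k) (sym (length-descending f)) n≤k)

  count≥-suc-kPlus1thLargest : ∀ f → k < n → count≥ (suc (kPlus1thLargest k f)) (values f) ≤ k
  count≥-suc-kPlus1thLargest f k<n = subst (_≤ k) (count≥-↭ _ (descending-↭ f))
    (count≥-suc-nth0 k (descending f) (descending-Descending f)
                     (subst (k <_) (sym (length-descending f)) k<n))

  kPlus1thLargest-count≥ : ∀ f → k < n → suc k ≤ count≥ (kPlus1thLargest k f) (values f)
  kPlus1thLargest-count≥ f k<n = subst (suc k ≤_) (count≥-↭ _ (descending-↭ f))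
    (nth0-count≥ k (descending f) (descending-Descending f)
                 (subst (k <_) (sym (length-descending f)) k<n))

  kPlus1thLargest-≤-+ : ∀ d (f g : Counters n) → (∀ i → f i ≤ d + g i) →
                        kPlus1thLargest k f ≤ d + kPlus1thLargest k g
  kPlus1thLargest-≤-+ d f g f≤d+g with k <? n
  ... | no k≮n = subst (_≤ _) (sym (kPlus1thLargest-≡0 f (≮⇒≥ k≮n))) z≤n
  ... | yes k<n = ≮⇒≥ λ tg<tf → <-irrefl refl (begin-strict
      k                                         <⟨ kPlus1thLargest-count≥ f k<n ⟩
      count≥ tf (values f)                      ≤⟨ count≥-map-≤ f g (allFin n) (above tg<tf) ⟩
      count≥ (suc tg) (values g)                ≤⟨ count≥-suc-kPlus1thLargest g k<n ⟩
      k                                         ∎)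
    where
    open ≤-Reasoning
    tf = kPlus1thLargest k f
    tg = kPlus1thLargest k g
    above : d + tg < tf → ∀ i → tf ≤ f i → suc tg ≤ g i
    above tg<tf i tf≤fi = +-cancelˡ-≤ d _ _
      (≤-trans (subst (_≤ tf) (sym (+-suc d tg)) tg<tf) (≤-trans tf≤fi (f≤d+g i)))

  kPlus1thLargest-AtMostOneAbove : ∀ (f g : Counters n) → (∀ i → AtMostOneAbove (f i) (g i)) →
                                   AtMostOneAbove (kPlus1thLargest k f) (kPlus1thLargest k g)
  kPlus1thLargest-AtMostOneAbove f g f≳g = ≥∧≤suc⇒AtMostOneAbove
    (kPlus1thLargest-≤-+ 0 g f (AtMostOneAbove⇒≥ ∘ f≳g))
    (kPlus1thLargest-≤-+ 1 f g (AtMostOneAbove⇒≤suc ∘ f≳g))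

lemma7p1 : (n k : ℕ) (c₁ c₁' c₂ : Counters n) →
    IsSketch k c₁ → IsSketch k c₁' → IsSketch k c₂ →
    c₁' ⊆T c₁ → DiffZeroOne c₁ c₁' →
    (Merge k c₁' c₂ ⊆T Merge k c₁ c₂ × DiffZeroOne (Merge k c₁ c₂) (Merge k c₁' c₂))
    ⊎ (Merge k c₁ c₂ ⊆T Merge k c₁' c₂ × DiffZeroOne (Merge k c₁' c₂) (Merge k c₁ c₂))
lemma7p1 n k c₁ c₁' c₂ _ _ _ c₁'⊆c₁ c₁-c₁'∈01 =
  Sum.map same-threshold larger-threshold (kPlus1thLargest-AtMostOneAbove k s s' s≳s')
  where
  s s' : Counters n
  s i = c₁ i + c₂ i
  s' i = c₁' i + c₂ i
  t t' : ℕ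
  t = kPlus1thLargest k s
  t' = kPlus1thLargest k s'
  s≳s' : ∀ i → AtMostOneAbove (s i) (s' i)
  s≳s' i = AtMostOneAbove-+ʳ (c₂ i) (⊆T×DiffZeroOne⇒AtMostOneAbove c₁'⊆c₁ c₁-c₁'∈01 i)
  same-threshold : t ≡ t' →
    Merge k c₁' c₂ ⊆T Merge k c₁ c₂ × DiffZeroOne (Merge k c₁ c₂) (Merge k c₁' c₂)
  same-threshold t≡t' = AtMostOneAbove⇒⊆T×DiffZeroOne λ i →
    subst (λ u → AtMostOneAbove (s i ∸ u) (s' i ∸ t')) (sym t≡t') (AtMostOneAbove-∸ t' (s≳s' i))
  larger-threshold : t ≡ suc t' →
    Merge k c₁ c₂ ⊆T Merge k c₁' c₂ × DiffZeroOne (Merge k c₁' c₂) (Merge k c₁ c₂)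
  larger-threshold t≡1+t' = AtMostOneAbove⇒⊆T×DiffZeroOne λ i →
    subst (λ u → AtMostOneAbove (s' i ∸ t') (s i ∸ u)) (sym t≡1+t') (AtMostOneAbove-∸-suc t' (s≳s' i))
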